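{- Let $n\ge 1$ and let $T$ be a standard Young tableau of shape $(n,n,n)$ with entries $1,\dots,3n$, and let $w_T$ be the web associated to $T$ by Tymoczko's $m$-diagram construction. If $(i,i+1)\in\tau(T)$, then the boundary vertices $i$ and $i+1$ of $w_T$ are joined by edges to the same internal vertex of $w_T$.
   Context: For a tableau $T$, $\tau(T)$ is the set of pairs $(i,i+1)$ such that $i$ lies in a row strictly above the row containing $i+1$. Webs: a web is a finite oriented graph embedded in the closed upper half-plane whose vertices on the boundary line (boundary vertices, numbered $1,2,\dots$ from left to right) are univalent, whose other vertices (internal vertices) are trivalent, and each internal vertex is either a source (all incident edges oriented outward) or a sink (all incident edges oriented inward). Tymoczko's construction: for a standard tableau $T$ of shape $(n,n,n)$ (top, middle, bottom rows), the $m$-diagram of $T$ is drawn as follows. Place points $1,\dots,3n$ from left to right on a horizontal line; all arcs are semicircles above the line. Processing the entries $j$ of the middle row in increasing order, draw an arc from $j$ to the largest entry $i<j$ of the top row not yet joined by such an arc to a middle-row entry (the left arcs). Then, processing the entries $k$ of the bottom row in increasing order, draw an arc from $k$ to the largest entry $j<k$ of the middle row not yet joined by such an arc to a bottom-row entry (the right arcs). The web $w_T$ is obtained from the $m$-diagram by: (1) at each middle-row point $j$ (which has one left and one right arc), replacing the neighbourhood of $j$ by a "Y": a single edge from boundary point $j$ up to a new internal vertex from which the left and right arc emanate; (2) orienting all edges away from the boundary points, so every boundary point is a source and each branch point of a Y is a sink (each arc is oriented from its top-row or bottom-row endpoint toward the Y of its middle-row endpoint); (3) replacing each crossing of a left arc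 with a right arc by two trivalent vertices joined by a new edge, the two incoming half-edges meeting at a new sink, the two outgoing half-edges meeting at a new source, the new edge oriented from the source to the sink. -}

module Defs where

open import Data.Nat using (ℕ; zero; suc; _+_; _*_; _∸_; _<_; _≤_; _<ᵇ_)
open import Data.Bool using (if_then_else_)
open import Data.Fin using (Fin; zero; suc) renaming (_<_ to _<ꟳ_)
open import Data.Integer as ℤ using (ℤ; +_)
open import Data.Rational.Unnormalised.Base as Q using (ℚᵘ; mkℚᵘ)
open import Data.List using (List; []; _∷_; tabulate; filter)
open import Data.List.Membership.Propositional using (_∈_)
open import Data.Maybe using (Maybe; nothing; just)
open import Data.Product using (_×_; _,_; ∃; ∃-syntax; Σ)
open import Data.Sum using (_⊎_)
open import Data.Unit using (⊤)
open import Relation.Nullary using (¬_; yes; no)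
open import Relation.Binary.PropositionalEquality using (_≡_; _≢_)
import Data.Nat as ℕ

-- Tableaux of shape (n,n,n).
-- A filling is a map  T : Fin 3 → Fin n → ℕ ;  T r c  is the entry in
-- row r, column c.  Row 0 = top, row 1 = middle, row 2 = bottom.

Filling : ℕ → Set
Filling n = Fin 3 → Fin n → ℕ

record IsStandard (n : ℕ) (T : Filling n) : Set where
  field
    inRange    : ∀ r c → 1 ≤ T r c × T r c ≤ 3 * n
    injective  : ∀ r c r' c' → T r c ≡ T r' c' → (r ≡ r') × (c ≡ c')
    surjective : ∀ k → 1 ≤ k → k ≤ 3 * n → ∃[ r ] ∃[ c ] T r c ≡ k
    rowsInc    : ∀ r c c' → c <ꟳ c' → T r c < T r c'
    colsInc    : ∀ r r' c → r <ꟳ r' → T r c < T r' c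

InRow : ∀ {n} → Filling n → ℕ → Fin 3 → Set
InRow T i r = ∃[ c ] T r c ≡ i

InTau : ∀ {n} → Filling n → ℕ → Set
InTau T i = ∃[ r ] ∃[ r' ] (InRow T i r × InRow T (suc i) r' × r <ꟳ r')

rowList : ∀ {n} → Filling n → Fin 3 → List ℕ
rowList T r = tabulate (T r)

maxBelow : ℕ → List ℕ → Maybe ℕ
maxBelow j [] = nothing
maxBelow j (x ∷ xs) with maxBelow j xs | x ℕ.<? j
... | nothing | yes _ = just x
... | nothing | no _  = nothing
... | just y  | yes _ = just (if y <ᵇ x then x else y)
... | just y  | no _  = just y

remove : ℕ → List ℕ → List ℕ
remove i [] = []
remove i (x ∷ xs) with x ℕ.≟ i
... | yes _ = xs
... | no _  = x ∷ remove i xs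

greedyMatch : List ℕ → List ℕ → List (ℕ × ℕ)
greedyMatch avail [] = []
greedyMatch avail (j ∷ js) with maxBelow j avail
... | nothing = greedyMatch avail js
... | just i  = (i , j) ∷ greedyMatch (remove i avail) js

leftArcs : ∀ {n} → Filling n → List (ℕ × ℕ)
leftArcs T = greedyMatch (rowList T zero) (rowList T (suc zero))

rightArcs : ∀ {n} → Filling n → List (ℕ × ℕ)
rightArcs T = greedyMatch (rowList T (suc zero)) (rowList T (suc (suc zero)))

-- two semicircles with endpoints (p , q) and (r , s) (p<q, r<s) cross
-- iff their endpoints strictly interleave
Crosses : ℕ × ℕ → ℕ × ℕ → Set
Crosses (p , q) (r , s) = (p < r × r < q × q < s) ⊎ (r < p × p < s × s < q)

-- x-coordinate of the intersection point of the semicircles over (p,q)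
-- and (r,s):  (r s − p q) / ((r + s) − (p + q))   (meaningful when they cross;
-- the denominator is then nonzero).
crossX : ℕ × ℕ → ℕ × ℕ → ℚᵘ
crossX (p , q) (r , s) =
  if (p + q) <ᵇ (r + s)
  then mkℚᵘ ((+ (r * s)) ℤ.- (+ (p * q))) ((r + s) ∸ (p + q) ∸ 1)
  else mkℚᵘ ((+ (p * q)) ℤ.- (+ (r * s))) ((p + q) ∸ (r + s) ∸ 1)

point : ℕ → ℚᵘ
point a = mkℚᵘ (+ a) 0

-- a left arc and a right arc are identified by their endpoint pairs
data Vertex : Set where
  bdry    : ℕ → Vertex
  yv      : ℕ → Vertex                  -- branch (sink) of the Y at middle point j
  sinkX   : ℕ × ℕ → ℕ × ℕ → Vertex
  sourceX : ℕ × ℕ → ℕ × ℕ → Vertex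

Internal : Vertex → Set
Internal v = ¬ (∃[ k ] v ≡ bdry k)

data ArcPt : Set where
  start : ArcPt
  cross : ℕ × ℕ → ArcPt
  end   : ArcPt

module _ {n : ℕ} (T : Filling n) where

  -- Left arc l = (a , j), traversed from a (top row) to j (middle row):
  -- x increases along it.
  ValidL : ℕ × ℕ → ArcPt → Set
  ValidL l start     = ⊤
  ValidL l (cross r) = r ∈ rightArcs T × Crosses l r
  ValidL l end       = ⊤

  xL : ℕ × ℕ → ArcPt → ℚᵘ
  xL (a , j) start     = point a
  xL (a , j) (cross r) = crossX (a , j) r
  xL (a , j) end       = point j

  ConsecL : ℕ × ℕ → ArcPt → ArcPt → Set
  ConsecL l u v = ValidL l u × ValidL l v × (xL l u Q.< xL l v)
                × (∀ r → r ∈ rightArcs T → Crosses l r →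
                     ¬ ((xL l u Q.< crossX l r) × (crossX l r Q.< xL l v)))

  outL : ℕ × ℕ → ArcPt → Vertex
  outL (a , j) start     = bdry a
  outL (a , j) (cross r) = sourceX (a , j) r
  outL (a , j) end       = yv j

  inL : ℕ × ℕ → ArcPt → Vertex
  inL (a , j) start     = bdry a
  inL (a , j) (cross r) = sinkX (a , j) r
  inL (a , j) end       = yv j

  -- Right arc r = (j , k), traversed from k (bottom row) to j (middle row):
  -- x decreases along it.
  ValidR : ℕ × ℕ → ArcPt → Set
  ValidR r start     = ⊤
  ValidR r (cross l) = l ∈ leftArcs T × Crosses l r
  ValidR r end       = ⊤

  xR : ℕ × ℕ → ArcPt → ℚᵘ
  xR (j , k) start     = point k
  xR (j , k) (cross l) = crossX l (j , k)
  xR (j , k) end       = point j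

  ConsecR : ℕ × ℕ → ArcPt → ArcPt → Set
  ConsecR r u v = ValidR r u × ValidR r v × (xR r v Q.< xR r u)
                × (∀ l → l ∈ leftArcs T → Crosses l r →
                     ¬ ((xR r v Q.< crossX l r) × (crossX l r Q.< xR r u)))

  outR : ℕ × ℕ → ArcPt → Vertex
  outR (j , k) start     = bdry k
  outR (j , k) (cross l) = sourceX l (j , k)
  outR (j , k) end       = yv j

  inR : ℕ × ℕ → ArcPt → Vertex
  inR (j , k) start     = bdry k
  inR (j , k) (cross l) = sinkX l (j , k)
  inR (j , k) end       = yv j

  data WebEdge : Vertex → Vertex → Set where
    stem     : ∀ j → j ∈ rowList T (suc zero) → WebEdge (bdry j) (yv j)
    crossE   : ∀ l r → l ∈ leftArcs T → r ∈ rightArcs T → Crosses l r →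
               WebEdge (sourceX l r) (sinkX l r)
    leftSeg  : ∀ l u v → l ∈ leftArcs T → ConsecL l u v →
               WebEdge (outL l u) (inL l v)
    rightSeg : ∀ r u v → r ∈ rightArcs T → ConsecR r u v →
               WebEdge (outR r u) (inR r v)

  Adjacent : Vertex → Vertex → Set
  Adjacent u v = WebEdge u v ⊎ WebEdge v u

-- Three cases, by the rows of i and i + 1.  If they lie in the top and middle rows (or in the
-- middle and bottom rows), the greedy matching joins i to i + 1 by an arc that no other arc
-- crosses, so both boundary vertices are adjacent to the Y-vertex of the middle-row one.  If
-- i is in the top row and i + 1 in the bottom row, the left arc leaving i and the right arc
-- ending at i + 1 cross, and the sink at that crossing is adjacent to both: no arc crosses
-- either of them earlier, because arcs of the same side never cross, and of two nested arcs
-- of one side the outer one meets a given arc of the other side later along it.  The latter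
-- is an inequality between the explicit crossing points of semicircles.

module Submission where

open import Defs
open import Data.Nat as ℕ using (ℕ; zero; suc; _+_; _*_; _∸_; _<_; _≤_; _<ᵇ_; z≤n; s≤s; z<s)
open import Data.Nat.Properties
open import Data.Nat.Tactic.RingSolver using (solve)
open import Data.Integer as ℤ using (+_)
import Data.Integer.Properties as ℤ
open import Data.Rational.Unnormalised.Base as ℚ using (ℚᵘ; mkℚᵘ; *<*)
import Data.Rational.Unnormalised.Properties as ℚ
open import Data.Bool using (true; false; T)
open import Data.Bool.Properties using (T-≡; ¬-not)
open import Data.Fin as Fin using (Fin; toℕ)
open import Data.Fin.Properties using (toℕ-injective)
open import Data.Product using (_×_; _,_; ∃-syntax; proj₁; proj₂)
open import Data.Sum using (_⊎_; inj₁; inj₂)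
open import Data.Unit using (⊤; tt)
open import Data.Empty using (⊥-elim)
open import Data.Maybe using (nothing; just)
open import Data.List using (List; []; _∷_; length; tabulate)
open import Data.List.Properties using (length-tabulate)
open import Data.List.Relation.Unary.Any using (here; there)
import Data.List.Relation.Unary.All as All
open import Data.List.Relation.Unary.AllPairs as AllPairs using (AllPairs)
open import Data.List.Relation.Unary.AllPairs.Properties using (tabulate⁺-<)
open import Data.List.Relation.Unary.Unique.Propositional using (Unique)
open import Data.List.Membership.Propositional using (_∈_; _∉_)
open import Data.List.Membership.Propositional.Properties using (∈-length; ∈-tabulate⁺; ∈-tabulate⁻)
open import Function using (_∘_; Equivalence)
open import Relation.Binary using (tri<; tri≈; tri>)
open import Relation.Nullary using (¬_; yes; no)
open import Relation.Binary.PropositionalEquality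

<ᵇ-true : ∀ {m n} → m < n → (m <ᵇ n) ≡ true
<ᵇ-true m<n = Equivalence.to T-≡ (<⇒<ᵇ m<n)

<ᵇ-false : ∀ {m n} → ¬ m < n → (m <ᵇ n) ≡ false
<ᵇ-false {m} {n} m≮n = ¬-not (m≮n ∘ <ᵇ⇒< m n ∘ Equivalence.from T-≡)

<⇒∃-suc : ∀ {m n} → m < n → ∃[ k ] n ≡ m + suc k
<⇒∃-suc {m} m<n with k , refl ← m≤n⇒∃[o]m+o≡n m<n = k , sym (+-suc m k)

≤⇒∃ : ∀ {m n} → m ≤ n → ∃[ k ] n ≡ m + k
≤⇒∃ m≤n with k , eq ← m≤n⇒∃[o]m+o≡n m≤n = k , sym eq

mkℚᵘ-< : ∀ {a d b e} → a * suc e < b * suc d → mkℚᵘ (+ a) d ℚ.< mkℚᵘ (+ b) e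
mkℚᵘ-< {a} {d} {b} {e} h = *<* (subst₂ ℤ._<_ (ℤ.pos-* a (suc e)) (ℤ.pos-* b (suc d)) (ℤ.+<+ h))

mkℚᵘ-≮ : ∀ {a d b e} → b * suc d ≤ a * suc e → ¬ (mkℚᵘ (+ a) d ℚ.< mkℚᵘ (+ b) e)
mkℚᵘ-≮ {a} {d} {b} {e} h (*<* lt) =
  ≤⇒≯ h (ℤ.drop‿+<+ (subst₂ ℤ._<_ (sym (ℤ.pos-* a (suc e))) (sym (ℤ.pos-* b (suc d))) lt))

point-< : ∀ {m n} → m < n → point m ℚ.< point n
point-< {m} {n} m<n = mkℚᵘ-< (subst₂ _<_ (sym (*-identityʳ m)) (sym (*-identityʳ n)) m<n)

point-≤ : ∀ {m n} → m ≤ n → point m ℚ.≤ point n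
point-≤ {m} {n} m≤n =
  ℚ.*≤* (subst₂ ℤ._≤_ (sym (ℤ.*-identityʳ (+ m))) (sym (ℤ.*-identityʳ (+ n))) (ℤ.+≤+ m≤n))

-- p + m / (1 + d)  and  q − m / (1 + d), the latter with truncated subtraction
plusFrac : ℕ → ℕ → ℕ → ℚᵘ
plusFrac p m d = mkℚᵘ (+ (p * suc d + m)) d

minusFrac : ℕ → ℕ → ℕ → ℚᵘ
minusFrac q m d = mkℚᵘ (+ (q * suc d ∸ m)) d

plusFrac≡minusFrac : ∀ {p q m m′ d} → q * suc d ≡ p * suc d + m + m′ → plusFrac p m d ≡ minusFrac q m′ d
plusFrac≡minusFrac {p} {q} {m} {m′} {d} eq =
  cong (λ x → mkℚᵘ (+ x) d) (sym (trans (cong (_∸ m′) eq) (m+n∸n≡m (p * suc d + m) m′)))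

point<plusFrac : ∀ {p m} d → 0 < m → point p ℚ.< plusFrac p m d
point<plusFrac {p} {m} d 0<m = mkℚᵘ-< (begin-strict
  p * suc d       <⟨ m<m+n (p * suc d) 0<m ⟩
  p * suc d + m   ≡⟨ sym (*-identityʳ _) ⟩
  (p * suc d + m) * 1 ∎)
  where open ≤-Reasoning

plusFrac<point : ∀ {p m k} d → m < k * suc d → plusFrac p m d ℚ.< point (p + k)
plusFrac<point {p} {m} {k} d m<kD = mkℚᵘ-< (begin-strict
  (p * suc d + m) * 1   ≡⟨ *-identityʳ _ ⟩
  p * suc d + m         <⟨ +-monoʳ-< (p * suc d) m<kD ⟩
  p * suc d + k * suc d ≡⟨ sym (*-distribʳ-+ (suc d) p k) ⟩
  (p + k) * suc d       ∎)
  where open ≤-Reasoning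

plusFrac-≮ : ∀ {p m d m′ d′} → m * suc d′ ≤ m′ * suc d → ¬ (plusFrac p m′ d′ ℚ.< plusFrac p m d)
plusFrac-≮ {p} {m} {d} {m′} {d′} h = mkℚᵘ-≮ (begin
  (p * suc d + m) * suc d′             ≡⟨ solve (p ∷ m ∷ d ∷ d′ ∷ []) ⟩
  p * suc d * suc d′ + m * suc d′      ≤⟨ +-monoʳ-≤ (p * suc d * suc d′) h ⟩
  p * suc d * suc d′ + m′ * suc d      ≡⟨ solve (p ∷ m′ ∷ d ∷ d′ ∷ []) ⟩
  (p * suc d′ + m′) * suc d            ∎)
  where open ≤-Reasoning

minusFrac-≮ : ∀ {q m d m′ d′} → m * suc d′ ≤ m′ * suc d → ¬ (minusFrac q m d ℚ.< minusFrac q m′ d′)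
minusFrac-≮ {q} {m} {d} {m′} {d′} h = mkℚᵘ-≮ (begin
  (q * suc d′ ∸ m′) * suc d            ≡⟨ *-distribʳ-∸ (suc d) (q * suc d′) m′ ⟩
  q * suc d′ * suc d ∸ m′ * suc d      ≤⟨ ∸-monoʳ-≤ (q * suc d′ * suc d) h ⟩
  q * suc d′ * suc d ∸ m * suc d′      ≡⟨ cong (_∸ m * suc d′) (solve (q ∷ d ∷ d′ ∷ [])) ⟩
  q * suc d * suc d′ ∸ m * suc d′      ≡⟨ sym (*-distribʳ-∸ (suc d′) (q * suc d) m) ⟩
  (q * suc d ∸ m) * suc d′             ∎)
  where open ≤-Reasoning

-- x y / (x + z) is increasing in x and y and decreasing in z
fracWeight-mono : ∀ {x x′ y y′ z z′} → x ≤ x′ → y ≤ y′ → z′ ≤ z →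
                  x * y * (x′ + z′) ≤ x′ * y′ * (x + z)
fracWeight-mono {x} {x′} {y} {y′} {z} {z′} x≤x′ y≤y′ z′≤z = begin
  x * y * (x′ + z′)       ≡⟨ solve (x ∷ x′ ∷ y ∷ z′ ∷ []) ⟩
  x′ * y * x + x * y * z′ ≤⟨ +-monoʳ-≤ (x′ * y * x) (*-mono-≤ (*-monoˡ-≤ y x≤x′) z′≤z) ⟩
  x′ * y * x + x′ * y * z ≡⟨ sym (*-distribˡ-+ (x′ * y) x z) ⟩
  x′ * y * (x + z)        ≤⟨ *-monoˡ-≤ (x + z) (*-monoʳ-≤ x′ y≤y′) ⟩
  x′ * y′ * (x + z)       ∎
  where open ≤-Reasoning

+[m+n]-+m≡+n : ∀ m n → + (m + n) ℤ.- + m ≡ + n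
+[m+n]-+m≡+n m n =
  trans (ℤ.[+m]-[+n]≡m⊖n (m + n) m) (trans (ℤ.⊖-≥ (m≤m+n m n)) (cong +_ (m+n∸m≡n m n)))

crossX-formula : ∀ {p q r s} → r + s < p + q →
                 crossX (p , q) (r , s) ≡ mkℚᵘ (+ (p * q) ℤ.- + (r * s)) (p + q ∸ (r + s) ∸ 1)
crossX-formula rs<pq rewrite <ᵇ-false (<⇒≯ rs<pq) = refl

crossX-comm : ∀ {p q r s} → p + q < r + s → crossX (p , q) (r , s) ≡ crossX (r , s) (p , q)
crossX-comm {p} {q} {r} {s} pq<rs rewrite <ᵇ-true pq<rs = sym (crossX-formula {r} {s} {p} {q} pq<rs)

-- Writing R < P < S < Q as P = R + 1 + a, S = P + 1 + b, Q = S + 1 + c, the crossing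
-- is at P + (P − R)(S − P) / ((P − R) + (Q − S)) = S − (S − P)(Q − S) / ((P − R) + (Q − S)).
crossX-plusFrac : ∀ {R P S Q a b c} → P ≡ R + suc a → S ≡ P + suc b → Q ≡ S + suc c →
                  crossX (P , Q) (R , S) ≡ plusFrac P (suc a * suc b) (a + suc c)
crossX-plusFrac {R} {a = a} {b} {c} refl refl refl =
  trans (crossX-formula {R + suc a} {S + suc c} {R} {S} (subst (R + S <_) (sym sum≡) (m<m+n (R + S) z<s)))
        (cong₂ mkℚᵘ (trans (cong (λ x → + x ℤ.- + (R * S)) prod≡) (+[m+n]-+m≡+n (R * S) _))
                    (cong (_∸ 1) (trans (cong (_∸ (R + S)) sum≡) (m+n∸m≡n (R + S) _))))
  where
  S = R + suc a + suc b
  sum≡ : (R + suc a) + (R + suc a + suc b + suc c) ≡ R + (R + suc a + suc b) + suc (a + suc c)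
  sum≡ = solve (R ∷ a ∷ b ∷ c ∷ [])
  prod≡ : (R + suc a) * (R + suc a + suc b + suc c)
        ≡ R * (R + suc a + suc b) + ((R + suc a) * suc (a + suc c) + suc a * suc b)
  prod≡ = solve (R ∷ a ∷ b ∷ c ∷ [])

crossX-minusFrac : ∀ {R P S Q a b c} → P ≡ R + suc a → S ≡ P + suc b → Q ≡ S + suc c →
                   crossX (P , Q) (R , S) ≡ minusFrac S (suc b * suc c) (a + suc c)
crossX-minusFrac {R} {a = a} {b} {c} eP@refl eS@refl eQ@refl =
  trans (crossX-plusFrac eP eS eQ)
        (plusFrac≡minusFrac {R + suc a} {R + suc a + suc b} {suc a * suc b} {suc b * suc c} identity)
  where
  identity : (R + suc a + suc b) * suc (a + suc c)
           ≡ (R + suc a) * suc (a + suc c) + suc a * suc b + suc b * suc c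
  identity = solve (R ∷ a ∷ b ∷ c ∷ [])

crossX-between : ∀ {R P S Q} → R < P → P < S → S < Q →
                 point P ℚ.< crossX (P , Q) (R , S) × crossX (P , Q) (R , S) ℚ.< point S
crossX-between R<P P<S S<Q
  with a , eP ← <⇒∃-suc R<P | b , refl ← <⇒∃-suc P<S | c , eQ ← <⇒∃-suc S<Q
  rewrite crossX-plusFrac eP refl eQ =
  point<plusFrac (a + suc c) z<s , plusFrac<point (a + suc c) ab<bd
  where
  open ≤-Reasoning
  ab<bd : suc a * suc b < suc b * suc (a + suc c)
  ab<bd = begin-strict
    suc a * suc b                 ≡⟨ *-comm (suc a) (suc b) ⟩
    suc b * suc a                 <⟨ m<m+n (suc b * suc a) z<s ⟩
    suc b * suc a + suc b * suc c ≡⟨ sym (*-distribˡ-+ (suc b) (suc a) (suc c)) ⟩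
    suc b * suc (a + suc c)       ∎

≡-+suc-+ : ∀ {x y z k l} → x ≡ y + suc l → y ≡ z + k → x ≡ z + suc (k + l)
≡-+suc-+ {z = z} {k} {l} refl refl = solve (z ∷ k ∷ l ∷ [])

≡-+-+suc : ∀ {x y z k l} → x ≡ y + k → y ≡ z + suc l → x ≡ z + suc (l + k)
≡-+-+suc {z = z} {k} {l} refl refl = solve (z ∷ k ∷ l ∷ [])

-- Along a left arc, a right arc nested around another one is crossed no earlier.
crossX-nestedʳ : ∀ {R′ R P S S′ Q} → R′ ≤ R → R < P → P < S → S ≤ S′ → S′ < Q →
                 ¬ (crossX (P , Q) (R′ , S′) ℚ.< crossX (P , Q) (R , S))
crossX-nestedʳ {P = P} R′≤R R<P P<S S≤S′ S′<Q
  with α , eR ← ≤⇒∃ R′≤R | a , eP ← <⇒∃-suc R<P | b , eS ← <⇒∃-suc P<S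
     | β , eS′ ← ≤⇒∃ S≤S′ | c , eQ ← <⇒∃-suc S′<Q
  = subst₂ (λ x y → ¬ (x ℚ.< y))
      (sym (crossX-plusFrac (≡-+suc-+ eP eR) (≡-+-+suc eS′ eS) eQ))
      (sym (crossX-plusFrac eP eS (≡-+suc-+ eQ eS′)))
      (plusFrac-≮ {P} {suc a * suc b} {a + suc (β + c)} {suc (α + a) * suc (b + β)} {α + a + suc c}
        (fracWeight-mono (s≤s (m≤n+m a α)) (s≤s (m≤m+n b β)) (s≤s (m≤n+m c β))))

-- Along a right arc, traversed leftwards, a left arc nested around another one is crossed no earlier.
crossX-nestedˡ : ∀ {R P′ P S Q Q′} → R < P′ → P′ ≤ P → P < S → S < Q → Q ≤ Q′ →
                 ¬ (crossX (P , Q) (R , S) ℚ.< crossX (P′ , Q′) (R , S))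
crossX-nestedˡ {S = S} R<P′ P′≤P P<S S<Q Q≤Q′
  with a , eP′ ← <⇒∃-suc R<P′ | α , eP ← ≤⇒∃ P′≤P | b , eS ← <⇒∃-suc P<S
     | c , eQ ← <⇒∃-suc S<Q | γ , eQ′ ← ≤⇒∃ Q≤Q′
  = subst₂ (λ x y → ¬ (x ℚ.< y))
      (sym (crossX-minusFrac (≡-+-+suc eP eP′) eS eQ))
      (sym (crossX-minusFrac eP′ (≡-+suc-+ eS eP) (≡-+-+suc eQ′ eQ)))
      (minusFrac-≮ {S} {suc b * suc c} {a + α + suc c} {suc (α + b) * suc (c + γ)} {a + suc (c + γ)} weights)
  where
  open ≤-Reasoning
  weights : suc b * suc c * suc (a + suc (c + γ)) ≤ suc (α + b) * suc (c + γ) * suc (a + α + suc c)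
  weights = begin
    suc b * suc c * suc (a + suc (c + γ))             ≡⟨ solve (a ∷ b ∷ c ∷ γ ∷ []) ⟩
    suc c * suc b * (suc (c + γ) + suc a)
      ≤⟨ fracWeight-mono (s≤s (m≤m+n c γ)) (s≤s (m≤n+m b α)) (s≤s (m≤m+n a α)) ⟩
    suc (c + γ) * suc (α + b) * (suc c + suc (a + α)) ≡⟨ solve (a ∷ b ∷ c ∷ α ∷ γ ∷ []) ⟩
    suc (α + b) * suc (c + γ) * suc (a + α + suc c)   ∎

unitArc-uncrossedˡ : ∀ {i} r → ¬ Crosses (i , suc i) r
unitArc-uncrossedˡ _ (inj₁ (i<r , r<si , _)) = <⇒≱ i<r (≤-pred r<si)
unitArc-uncrossedˡ _ (inj₂ (_ , i<s , s<si)) = <⇒≱ i<s (≤-pred s<si)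

unitArc-uncrossedʳ : ∀ {i} l → ¬ Crosses l (i , suc i)
unitArc-uncrossedʳ _ (inj₁ (_ , i<q , q<si)) = <⇒≱ i<q (≤-pred q<si)
unitArc-uncrossedʳ _ (inj₂ (i<p , p<si , _)) = <⇒≱ i<p (≤-pred p<si)

module GreedyMatching where
  open import Data.List.Relation.Unary.All using ([]; _∷_)
  open import Data.List.Relation.Unary.AllPairs using ([]; _∷_)

  maxBelow-nothing : ∀ {j L x} → maxBelow j L ≡ nothing → x ∈ L → ¬ x < j
  maxBelow-nothing {j} {x ∷ xs} eq x∈ with maxBelow j xs in e | x ℕ.<? j
  maxBelow-nothing {j} {x ∷ xs} () _            | nothing | yes _
  maxBelow-nothing {j} {x ∷ xs} eq (here refl)  | nothing | no x≮j = x≮j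
  maxBelow-nothing {j} {x ∷ xs} eq (there y∈xs) | nothing | no _   = maxBelow-nothing e y∈xs
  maxBelow-nothing {j} {x ∷ xs} () _            | just _  | yes _
  maxBelow-nothing {j} {x ∷ xs} () _            | just _  | no _

  maxBelow-just : ∀ {j L i} → maxBelow j L ≡ just i →
                  i ∈ L × i < j × (∀ {x} → x ∈ L → x < j → x ≤ i)
  maxBelow-just {j} {x ∷ xs} eq with maxBelow j xs in e | x ℕ.<? j
  maxBelow-just {j} {x ∷ xs} refl | nothing | yes x<j =
    here refl , x<j , λ { (here refl) _ → ≤-refl ; (there y∈xs) y<j → ⊥-elim (maxBelow-nothing e y∈xs y<j) }
  maxBelow-just {j} {x ∷ xs} () | nothing | no _
  maxBelow-just {j} {x ∷ xs} eq | just y | yes x<j with maxBelow-just {j} {xs} e | y ℕ.<ᵇ x in y<ᵇx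
  maxBelow-just {j} {x ∷ xs} refl | just y | yes x<j | _ , _ , y-max | true =
    here refl , x<j , λ { (here refl) _ → ≤-refl
                        ; (there z∈xs) z<j →
                            <⇒≤ (≤-<-trans (y-max z∈xs z<j) (<ᵇ⇒< y x (subst T (sym y<ᵇx) tt))) }
  maxBelow-just {j} {x ∷ xs} refl | just y | yes x<j | y∈xs , y<j , y-max | false =
    there y∈xs , y<j , λ { (here refl) _ → ≮⇒≥ (λ y<x → subst T y<ᵇx (<⇒<ᵇ y<x))
                         ; (there z∈xs) z<j → y-max z∈xs z<j }
  maxBelow-just {j} {x ∷ xs} refl | just y | no x≮j with maxBelow-just e
  ... | y∈xs , y<j , y-max =
    there y∈xs , y<j , λ { (here refl) x<j → ⊥-elim (x≮j x<j) ; (there z∈xs) z<j → y-max z∈xs z<j }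

  ∈-remove⁻ : ∀ {x} i L → x ∈ remove i L → x ∈ L
  ∈-remove⁻ i (y ∷ ys) x∈ with y ℕ.≟ i
  ... | yes _ = there x∈
  ∈-remove⁻ i (y ∷ ys) (here refl) | no _ = here refl
  ∈-remove⁻ i (y ∷ ys) (there x∈)  | no _ = there (∈-remove⁻ i ys x∈)

  ∈-remove⁺ : ∀ {x} i L → x ∈ L → x ≢ i → x ∈ remove i L
  ∈-remove⁺ i (y ∷ ys) x∈ x≢i with y ℕ.≟ i
  ∈-remove⁺ i (y ∷ ys) (here refl) x≢i | yes y≡i = ⊥-elim (x≢i y≡i)
  ∈-remove⁺ i (y ∷ ys) (there x∈)  x≢i | yes _   = x∈
  ∈-remove⁺ i (y ∷ ys) (here refl) x≢i | no _    = here refl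
  ∈-remove⁺ i (y ∷ ys) (there x∈)  x≢i | no _    = there (∈-remove⁺ i ys x∈ x≢i)

  length-remove : ∀ {i} L → i ∈ L → suc (length (remove i L)) ≡ length L
  length-remove {i} (y ∷ ys) i∈ with y ℕ.≟ i
  ... | yes _ = refl
  length-remove {i} (y ∷ ys) (here refl) | no y≢i = ⊥-elim (y≢i refl)
  length-remove {i} (y ∷ ys) (there i∈)  | no _   = cong suc (length-remove ys i∈)

  remove-∉ : ∀ i L → Unique L → i ∉ remove i L
  remove-∉ i (y ∷ ys) (y∉ys ∷ uniq) i∈ with y ℕ.≟ i
  remove-∉ i (y ∷ ys) (y∉ys ∷ uniq) i∈          | yes refl = All.lookup y∉ys i∈ refl
  remove-∉ i (y ∷ ys) (y∉ys ∷ uniq) (here refl) | no y≢i   = y≢i refl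
  remove-∉ i (y ∷ ys) (y∉ys ∷ uniq) (there i∈)  | no _     = remove-∉ i ys uniq i∈

  remove-unique : ∀ i L → Unique L → Unique (remove i L)
  remove-unique i [] [] = []
  remove-unique i (y ∷ ys) (y∉ys ∷ uniq) with y ℕ.≟ i
  ... | yes _ = uniq
  ... | no _  = All.tabulate (λ x∈ → All.lookup y∉ys (∈-remove⁻ i ys x∈)) ∷ remove-unique i ys uniq

  countBelow : ℕ → List ℕ → ℕ
  countBelow j [] = 0
  countBelow j (x ∷ xs) with x ℕ.<? j
  ... | yes _ = suc (countBelow j xs)
  ... | no _  = countBelow j xs

  countBelow-∃ : ∀ {j} L → 0 < countBelow j L → ∃[ x ] (x ∈ L × x < j)
  countBelow-∃ {j} (x ∷ xs) pos with x ℕ.<? j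
  ... | yes x<j = x , here refl , x<j
  ... | no _ with y , y∈ , y<j ← countBelow-∃ xs pos = y , there y∈ , y<j

  countBelow-remove : ∀ j i L → countBelow j L ≤ suc (countBelow j (remove i L))
  countBelow-remove j i [] = z≤n
  countBelow-remove j i (y ∷ ys) with y ℕ.≟ i
  countBelow-remove j i (y ∷ ys) | yes _ with y ℕ.<? j
  ... | yes _ = ≤-refl
  ... | no _  = n≤1+n _
  countBelow-remove j i (y ∷ ys) | no _ with y ℕ.<? j
  ... | yes _ = s≤s (countBelow-remove j i ys)
  ... | no _  = countBelow-remove j i ys

  ∈-greedyMatch⁻ : ∀ {a b} L js → (a , b) ∈ greedyMatch L js → a ∈ L × b ∈ js × a < b
  ∈-greedyMatch⁻ L (j ∷ js) ab∈ with maxBelow j L in e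
  ... | nothing with a∈ , b∈ , a<b ← ∈-greedyMatch⁻ L js ab∈ = a∈ , there b∈ , a<b
  ∈-greedyMatch⁻ L (j ∷ js) (here refl) | just i with i∈ , i<j , _ ← maxBelow-just e = i∈ , here refl , i<j
  ∈-greedyMatch⁻ L (j ∷ js) (there ab∈) | just i with a∈ , b∈ , a<b ← ∈-greedyMatch⁻ (remove i L) js ab∈ =
    ∈-remove⁻ i L a∈ , there b∈ , a<b

  greedyMatch-nonCrossing : ∀ {a b c d} L js → AllPairs _<_ js →
                            (a , b) ∈ greedyMatch L js → (c , d) ∈ greedyMatch L js →
                            a < c → c < b → ¬ b < d
  greedyMatch-nonCrossing L (j ∷ js) (j<js ∷ sorted) ab∈ cd∈ a<c c<b b<d with maxBelow j L in e
  ... | nothing = greedyMatch-nonCrossing L js sorted ab∈ cd∈ a<c c<b b<d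
  greedyMatch-nonCrossing L (j ∷ js) _ (here refl) (here refl) a<c _ _ | just i = <-irrefl refl a<c
  greedyMatch-nonCrossing L (j ∷ js) _ (here refl) (there cd∈) a<c c<b _ | just i
    with c∈ , _ ← ∈-greedyMatch⁻ (remove i L) js cd∈ | _ , _ , i-max ← maxBelow-just e =
    <⇒≱ a<c (i-max (∈-remove⁻ i L c∈) c<b)
  greedyMatch-nonCrossing L (j ∷ js) (j<js ∷ _) (there ab∈) (here refl) _ _ b<d | just i
    with _ , b∈ , _ ← ∈-greedyMatch⁻ (remove i L) js ab∈ = <-asym b<d (All.lookup j<js b∈)
  greedyMatch-nonCrossing L (j ∷ js) (_ ∷ sorted) (there ab∈) (there cd∈) a<c c<b b<d | just i =
    greedyMatch-nonCrossing (remove i L) js sorted ab∈ cd∈ a<c c<b b<d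

  greedyMatch-injectiveˡ : ∀ {a b d} L js → Unique L →
                           (a , b) ∈ greedyMatch L js → (a , d) ∈ greedyMatch L js → b ≡ d
  greedyMatch-injectiveˡ L (j ∷ js) uniq ab∈ ad∈ with maxBelow j L in e
  ... | nothing = greedyMatch-injectiveˡ L js uniq ab∈ ad∈
  greedyMatch-injectiveˡ L (j ∷ js) uniq (here refl) (here refl) | just i = refl
  greedyMatch-injectiveˡ L (j ∷ js) uniq (here refl) (there ad∈) | just i =
    ⊥-elim (remove-∉ i L uniq (proj₁ (∈-greedyMatch⁻ (remove i L) js ad∈)))
  greedyMatch-injectiveˡ L (j ∷ js) uniq (there ab∈) (here refl) | just i =
    ⊥-elim (remove-∉ i L uniq (proj₁ (∈-greedyMatch⁻ (remove i L) js ab∈)))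
  greedyMatch-injectiveˡ L (j ∷ js) uniq (there ab∈) (there ad∈) | just i =
    greedyMatch-injectiveˡ (remove i L) js (remove-unique i L uniq) ab∈ ad∈

  greedyMatch-injectiveʳ : ∀ {a b c} L js → Unique js →
                           (a , b) ∈ greedyMatch L js → (c , b) ∈ greedyMatch L js → a ≡ c
  greedyMatch-injectiveʳ L (j ∷ js) (j∉js ∷ uniq) ab∈ cb∈ with maxBelow j L in e
  ... | nothing = greedyMatch-injectiveʳ L js uniq ab∈ cb∈
  greedyMatch-injectiveʳ L (j ∷ js) _ (here refl) (here refl) | just i = refl
  greedyMatch-injectiveʳ L (j ∷ js) (j∉js ∷ _) (here refl) (there cb∈) | just i =
    ⊥-elim (All.lookup j∉js (proj₁ (proj₂ (∈-greedyMatch⁻ (remove i L) js cb∈))) refl)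
  greedyMatch-injectiveʳ L (j ∷ js) (j∉js ∷ _) (there ab∈) (here refl) | just i =
    ⊥-elim (All.lookup j∉js (proj₁ (proj₂ (∈-greedyMatch⁻ (remove i L) js ab∈))) refl)
  greedyMatch-injectiveʳ L (j ∷ js) (_ ∷ uniq) (there ab∈) (there cb∈) | just i =
    greedyMatch-injectiveʳ (remove i L) js uniq ab∈ cb∈

  greedyMatch-adjacent : ∀ {i} L js → AllPairs _<_ js → i ∈ L → suc i ∈ js → (i , suc i) ∈ greedyMatch L js
  greedyMatch-adjacent {i} L (j ∷ js) (j<js ∷ sorted) i∈ si∈ with maxBelow j L in e | si∈
  ... | nothing | here refl  = ⊥-elim (maxBelow-nothing e i∈ (n<1+n i))
  ... | nothing | there si∈js = greedyMatch-adjacent L js sorted i∈ si∈js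
  ... | just k  | here refl with _ , k<si , k-max ← maxBelow-just {suc i} {L} e =
    here (cong (_, suc i) (≤-antisym (k-max i∈ (n<1+n i)) (≤-pred k<si)))
  ... | just k  | there si∈js with _ , k<j , _ ← maxBelow-just {j} {L} e =
    there (greedyMatch-adjacent (remove k L) js sorted (∈-remove⁺ k L i∈ i≢k) si∈js)
    where
    i≢k : i ≢ k
    i≢k refl = <⇒≱ k<j (≤-pred (All.lookup j<js si∈js))

  greedyLeftover : List ℕ → List ℕ → List ℕ
  greedyLeftover L [] = L
  greedyLeftover L (j ∷ js) with maxBelow j L
  ... | nothing = greedyLeftover L js
  ... | just i  = greedyLeftover (remove i L) js

  greedyMatch-leftover : ∀ {x} L js → x ∈ L → x ∈ greedyLeftover L js ⊎ ∃[ y ] (x , y) ∈ greedyMatch L js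
  greedyMatch-leftover L [] x∈ = inj₁ x∈
  greedyMatch-leftover L (j ∷ js) x∈ with maxBelow j L
  ... | nothing = greedyMatch-leftover L js x∈
  greedyMatch-leftover {x} L (j ∷ js) x∈ | just i with x ℕ.≟ i
  ... | yes refl = inj₂ (j , here refl)
  ... | no x≢i with greedyMatch-leftover (remove i L) js (∈-remove⁺ i L x∈ x≢i)
  ...   | inj₁ x∈left     = inj₁ x∈left
  ...   | inj₂ (y , xy∈) = inj₂ (y , there xy∈)

  -- The m-th entry of js (m = 1, 2, …) exceeds at least k + m entries of L.
  Ballot : ℕ → List ℕ → List ℕ → Set
  Ballot k L [] = ⊤
  Ballot k L (j ∷ js) = k < countBelow j L × Ballot (suc k) L js

  Ballot-remove : ∀ {k} i L js → Ballot (suc k) L js → Ballot k (remove i L) js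
  Ballot-remove i L [] _ = tt
  Ballot-remove i L (j ∷ js) (k<count , ballot) =
    ≤-pred (≤-trans k<count (countBelow-remove j i L)) , Ballot-remove i L js ballot

  countBelow-maxBelow : ∀ {j k} L → k < countBelow j L → maxBelow j L ≢ nothing
  countBelow-maxBelow L k<count none with x , x∈ , x<j ← countBelow-∃ L (<-≤-trans z<s k<count) =
    maxBelow-nothing none x∈ x<j

  greedyMatch-matchesʳ : ∀ {j} L js → Ballot 0 L js → j ∈ js → ∃[ a ] (a , j) ∈ greedyMatch L js
  greedyMatch-matchesʳ L (j ∷ js) (0<count , ballot) j∈ with maxBelow j L in e
  ... | nothing = ⊥-elim (countBelow-maxBelow L 0<count e)
  greedyMatch-matchesʳ L (j ∷ js) _ (here refl) | just i = i , here refl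
  greedyMatch-matchesʳ L (j ∷ js) (_ , ballot) (there j∈) | just i
    with a , aj∈ ← greedyMatch-matchesʳ (remove i L) js (Ballot-remove i L js ballot) j∈ = a , there aj∈

  length-greedyLeftover : ∀ L js → Ballot 0 L js → length L ≡ length (greedyLeftover L js) + length js
  length-greedyLeftover L [] _ = sym (+-identityʳ (length L))
  length-greedyLeftover L (j ∷ js) (0<count , ballot) with maxBelow j L in e
  ... | nothing = ⊥-elim (countBelow-maxBelow L 0<count e)
  ... | just i  with i∈ , _ ← maxBelow-just {j} {L} e = begin
    length L                                                  ≡⟨ length-remove L i∈ ⟨
    suc (length (remove i L))                                 ≡⟨ cong suc (length-greedyLeftover (remove i L) js
                                                                             (Ballot-remove i L js ballot)) ⟩
    suc (length (greedyLeftover (remove i L) js) + length js) ≡⟨ +-suc _ (length js) ⟨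
    length (greedyLeftover (remove i L) js) + suc (length js) ∎
    where open ≡-Reasoning

  greedyMatch-matchesˡ : ∀ {x} L js → Ballot 0 L js → length L ≡ length js →
                         x ∈ L → ∃[ y ] (x , y) ∈ greedyMatch L js
  greedyMatch-matchesˡ L js ballot |L|≡|js| x∈ with greedyMatch-leftover L js x∈
  ... | inj₂ matched = matched
  ... | inj₁ x∈left = ⊥-elim (<-irrefl refl (begin-strict
    length js                                  <⟨ m<n+m (length js) (∈-length x∈left) ⟩
    length (greedyLeftover L js) + length js   ≡⟨ length-greedyLeftover L js ballot ⟨
    length L                                   ≡⟨ |L|≡|js| ⟩
    length js                                  ∎))
    where open ≤-Reasoning

  greedyMatch-nested : ∀ {a b c d} L js → AllPairs _<_ js →
                       (a , b) ∈ greedyMatch L js → (c , d) ∈ greedyMatch L js → a < c → c < b → d < b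
  greedyMatch-nested {a} {b} {c} {d} L js sorted ab∈ cd∈ a<c c<b with <-cmp d b
  ... | tri< d<b _ _ = d<b
  ... | tri≈ _ refl _ = ⊥-elim (<-irrefl (greedyMatch-injectiveʳ L js (AllPairs.map <⇒≢ sorted) ab∈ cd∈) a<c)
  ... | tri> _ _ b<d = ⊥-elim (greedyMatch-nonCrossing L js sorted ab∈ cd∈ a<c c<b b<d)

open GreedyMatching

countBelow-tabulate : ∀ {m} (f : Fin m → ℕ) x (c : Fin m) → (∀ c′ → c′ Fin.≤ c → f c′ < x) →
                      toℕ c < countBelow x (tabulate f)
countBelow-tabulate {suc m} f x c below with f Fin.zero ℕ.<? x
... | no f0≮x = ⊥-elim (f0≮x (below Fin.zero z≤n))
countBelow-tabulate {suc m} f x Fin.zero below | yes _ = s≤s z≤n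
countBelow-tabulate {suc m} f x (Fin.suc c) below | yes _ =
  s≤s (countBelow-tabulate (λ c′ → f (Fin.suc c′)) x c (λ c′ c′≤c → below (Fin.suc c′) (s≤s c′≤c)))

Ballot-tabulate : ∀ {m} (g : Fin m → ℕ) L k → (∀ c → k + toℕ c < countBelow (g c) L) → Ballot k L (tabulate g)
Ballot-tabulate {zero} g L k ballot = tt
Ballot-tabulate {suc m} g L k ballot =
  subst (_< countBelow (g Fin.zero) L) (+-identityʳ k) (ballot Fin.zero) ,
  Ballot-tabulate (λ c → g (Fin.suc c)) L (suc k)
    (λ c → subst (_< countBelow (g (Fin.suc c)) L) (+-suc k (toℕ c)) (ballot (Fin.suc c)))

SharedNeighbour : ∀ {n} → Filling n → ℕ → Set
SharedNeighbour T i = ∃[ v ] (Internal v × Adjacent T (bdry i) v × Adjacent T (bdry (suc i)) v)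

pattern top    = Fin.zero
pattern middle = Fin.suc Fin.zero
pattern bottom = Fin.suc (Fin.suc Fin.zero)

module _ {n} {T : Filling n} (standard : IsStandard n T) where
  open IsStandard standard

  rowList-sorted : ∀ r → AllPairs _<_ (rowList T r)
  rowList-sorted r = tabulate⁺-< (rowsInc r _ _)

  rowList-unique : ∀ r → Unique (rowList T r)
  rowList-unique r = AllPairs.map <⇒≢ (rowList-sorted r)

  entry-<-southEast : ∀ {r r′ c′ c} → r Fin.< r′ → c′ Fin.≤ c → T r c′ < T r′ c
  entry-<-southEast {r} {r′} {c′} {c} r<r′ c′≤c with m≤n⇒m<n∨m≡n c′≤c
  ... | inj₁ c′<c = <-trans (rowsInc r c′ c c′<c) (colsInc r r′ c r<r′)
  ... | inj₂ c′≡c rewrite toℕ-injective c′≡c = colsInc r r′ c r<r′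

  rowList-ballot : ∀ {r r′} → r Fin.< r′ → Ballot 0 (rowList T r) (rowList T r′)
  rowList-ballot {r} {r′} r<r′ = Ballot-tabulate (T r′) (rowList T r) 0
    (λ c → countBelow-tabulate (T r) (T r′ c) c (λ c′ c′≤c → entry-<-southEast r<r′ c′≤c))

  length-rowList : ∀ r r′ → length (rowList T r) ≡ length (rowList T r′)
  length-rowList r r′ = trans (length-tabulate (T r)) (sym (length-tabulate (T r′)))

  InRow⇒∈ : ∀ {i r} → InRow T i r → i ∈ rowList T r
  InRow⇒∈ {r = r} (c , refl) = ∈-tabulate⁺ {f = T r} c

  ∈-other-row⇒≢ : ∀ {j k r r′} → j ∈ rowList T r → InRow T k r′ → r ≢ r′ → j ≢ k
  ∈-other-row⇒≢ {r = r} {r′} j∈ (c′ , refl) r≢r′ refl with c , j≡ ← ∈-tabulate⁻ {f = T r} j∈ =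
    r≢r′ (proj₁ (injective r c r′ c′ (sym j≡)))

  ∈-leftArcs⁻ : ∀ {a b} → (a , b) ∈ leftArcs T → a ∈ rowList T top × b ∈ rowList T middle × a < b
  ∈-leftArcs⁻ = ∈-greedyMatch⁻ (rowList T top) (rowList T middle)

  ∈-rightArcs⁻ : ∀ {a b} → (a , b) ∈ rightArcs T → a ∈ rowList T middle × b ∈ rowList T bottom × a < b
  ∈-rightArcs⁻ = ∈-greedyMatch⁻ (rowList T middle) (rowList T bottom)

  leftArc-from : ∀ {i} → InRow T i top → ∃[ j ] (i , j) ∈ leftArcs T
  leftArc-from i∈top = greedyMatch-matchesˡ (rowList T top) (rowList T middle)
    (rowList-ballot z<s) (length-rowList top middle) (InRow⇒∈ i∈top)

  rightArc-into : ∀ {k} → InRow T k bottom → ∃[ j ] (j , k) ∈ rightArcs T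
  rightArc-into k∈bottom = greedyMatch-matchesʳ (rowList T middle) (rowList T bottom)
    (rowList-ballot (s≤s z<s)) (InRow⇒∈ k∈bottom)

  leftArcs-nested : ∀ {a b c d} → (a , b) ∈ leftArcs T → (c , d) ∈ leftArcs T → a < c → c < b → d < b
  leftArcs-nested = greedyMatch-nested (rowList T top) (rowList T middle) (rowList-sorted middle)

  rightArcs-nested : ∀ {a b c d} → (a , b) ∈ rightArcs T → (c , d) ∈ rightArcs T → a < c → c < b → d < b
  rightArcs-nested = greedyMatch-nested (rowList T middle) (rowList T bottom) (rowList-sorted bottom)

  topMiddle : ∀ {i} → InRow T i top → InRow T (suc i) middle → SharedNeighbour T i
  topMiddle {i} i∈top si∈middle =
    yv (suc i) , (λ { (_ , ()) }) ,
    inj₁ (leftSeg (i , suc i) start end arc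
           (tt , tt , point-< (n<1+n i) , λ r _ r-crosses _ → unitArc-uncrossedˡ r r-crosses)) ,
    inj₁ (stem (suc i) (InRow⇒∈ si∈middle))
    where
    arc : (i , suc i) ∈ leftArcs T
    arc = greedyMatch-adjacent (rowList T top) (rowList T middle) (rowList-sorted middle)
            (InRow⇒∈ i∈top) (InRow⇒∈ si∈middle)

  middleBottom : ∀ {i} → InRow T i middle → InRow T (suc i) bottom → SharedNeighbour T i
  middleBottom {i} i∈middle si∈bottom =
    yv i , (λ { (_ , ()) }) ,
    inj₁ (stem i (InRow⇒∈ i∈middle)) ,
    inj₁ (rightSeg (i , suc i) start end arc
           (tt , tt , point-< (n<1+n i) , λ l _ l-crosses _ → unitArc-uncrossedʳ l l-crosses))
    where
    arc : (i , suc i) ∈ rightArcs T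
    arc = greedyMatch-adjacent (rowList T middle) (rowList T bottom) (rowList-sorted bottom)
            (InRow⇒∈ i∈middle) (InRow⇒∈ si∈bottom)

  topBottom : ∀ {i} → InRow T i top → InRow T (suc i) bottom → SharedNeighbour T i
  topBottom {i} i∈top si∈bottom
    with j , ij∈ ← leftArc-from i∈top | j′ , j′si∈ ← rightArc-into si∈bottom
    = sinkX (i , j) (j′ , suc i) , (λ { (_ , ()) }) ,
      inj₁ (leftSeg (i , j) start (cross (j′ , suc i)) ij∈
             (tt , (j′si∈ , crossing) , proj₁ X-between , firstOnLeftArc)) ,
      inj₁ (rightSeg (j′ , suc i) start (cross (i , j)) j′si∈
             (tt , (ij∈ , crossing) , proj₂ X-between , firstOnRightArc))
    where
    i<si : i < suc i
    i<si = n<1+n i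

    si<j : suc i < j
    si<j with _ , j∈middle , i<j ← ∈-leftArcs⁻ ij∈ =
      ≤∧≢⇒< i<j (∈-other-row⇒≢ j∈middle si∈bottom (λ ()) ∘ sym)

    j′<i : j′ < i
    j′<i with j′∈middle , _ , j′<si ← ∈-rightArcs⁻ j′si∈ =
      ≤∧≢⇒< (≤-pred j′<si) (∈-other-row⇒≢ j′∈middle i∈top (λ ()))

    crossing : Crosses (i , j) (j′ , suc i)
    crossing = inj₂ (j′<i , i<si , si<j)

    X = crossX (i , j) (j′ , suc i)

    X-between : point i ℚ.< X × X ℚ.< point (suc i)
    X-between = crossX-between j′<i i<si si<j

    firstOnLeftArc : ∀ r → r ∈ rightArcs T → Crosses (i , j) r →
                     ¬ (point i ℚ.< crossX (i , j) r × crossX (i , j) r ℚ.< X)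
    firstOnLeftArc (a , b) _ (inj₁ (i<a , a<j , j<b)) (_ , Y<X) =
      ℚ.<-asym Y<X (ℚ.<-trans (ℚ.<-≤-trans (proj₂ X-between) (point-≤ i<a))
        (subst (point a ℚ.<_) (sym (crossX-comm {i} {j} {a} {b} (+-mono-< i<a j<b)))
          (proj₁ (crossX-between i<a a<j j<b))))
    firstOnLeftArc (a , b) ab∈ (inj₂ (a<i , i<b , b<j)) (_ , Y<X) with a ℕ.≤? j′
    ... | yes a≤j′ = crossX-nestedʳ a≤j′ j′<i i<si i<b b<j Y<X
    ... | no a≰j′ = <⇒≱ i<b (≤-pred (rightArcs-nested j′si∈ ab∈ (≰⇒> a≰j′) (<-trans a<i i<si)))

    firstOnRightArc : ∀ l → l ∈ leftArcs T → Crosses l (j′ , suc i) →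
                      ¬ (X ℚ.< crossX l (j′ , suc i) × crossX l (j′ , suc i) ℚ.< point (suc i))
    firstOnRightArc (c , d) _ (inj₁ (c<j′ , j′<d , d<si)) (X<Y , _) =
      ℚ.<-asym X<Y (ℚ.<-trans (ℚ.<-≤-trans
        (subst (ℚ._< point d) (sym (crossX-comm {c} {d} {j′} {suc i} (+-mono-< c<j′ d<si)))
          (proj₂ (crossX-between c<j′ j′<d d<si)))
        (point-≤ (≤-pred d<si))) (proj₁ X-between))
    firstOnRightArc (c , d) cd∈ (inj₂ (j′<c , c<si , si<d)) (X<Y , _) with j ℕ.≤? d
    ... | yes j≤d = crossX-nestedˡ j′<c (≤-pred c<si) i<si si<j j≤d X<Y
    ... | no j≰d with m≤n⇒m<n∨m≡n (≤-pred c<si)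
    ...   | inj₁ c<i = <-asym (≰⇒> j≰d) (leftArcs-nested cd∈ ij∈ c<i (<-trans i<si si<d))
    ...   | inj₂ refl =
      <-irrefl (sym (greedyMatch-injectiveˡ (rowList T top) (rowList T middle) (rowList-unique top) ij∈ cd∈))
               (≰⇒> j≰d)

mainTheorem1 : (n : ℕ) → 1 ≤ n → (T : Filling n) → IsStandard n T →
    (i : ℕ) → InTau T i →
    ∃[ v ] (Internal v × Adjacent T (bdry i) v × Adjacent T (bdry (suc i)) v)
mainTheorem1 n _ T standard i (top    , middle , i∈ , si∈ , _) = topMiddle standard i∈ si∈
mainTheorem1 n _ T standard i (top    , bottom , i∈ , si∈ , _) = topBottom standard i∈ si∈
mainTheorem1 n _ T standard i (middle , bottom , i∈ , si∈ , _) = middleBottom standard i∈ si∈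
mainTheorem1 n _ T standard i (top    , top    , _ , _ , ())
mainTheorem1 n _ T standard i (middle , top    , _ , _ , ())
mainTheorem1 n _ T standard i (middle , middle , _ , _ , s≤s ())
mainTheorem1 n _ T standard i (bottom , top    , _ , _ , ())
mainTheorem1 n _ T standard i (bottom , middle , _ , _ , s≤s ())
mainTheorem1 n _ T standard i (bottom , bottom , _ , _ , s≤s (s≤s ()))
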